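{- Let $\Gamma$ be the block graph of an orthogonal array $OA(n,m)$ and suppose $n>(m-1)^2$. Then $\Gamma$ is $n$-clique regular and $C_n(\Gamma)$ is isomorphic to the complete $m$-partite graph in which each part has $n$ vertices.
   Context: An orthogonal array $OA(n,m)$ is an $n^2\times m$ array with entries from an $n$-element set such that, for any two distinct columns, the $n^2$ rows restricted to those two columns contain every ordered pair of symbols exactly once. Its block graph has the $n^2$ rows as vertices, two rows being adjacent iff they have the same entry in some column. A clique of order $\omega$ is a set of $\omega$ pairwise adjacent vertices; a graph is $\omega$-clique regular if it has a nonempty edge set and every edge lies in exactly one clique of order $\omega$. The $\omega$-clique graph $C_\omega(\Gamma)$ has as vertices the cliques of order $\omega$ in $\Gamma$, two distinct cliques being adjacent iff they have nonempty intersection. -}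

module Defs where

open import Data.Nat using (ℕ; _*_)
open import Data.Fin using (Fin)
open import Data.Fin.Subset using (Subset; _∈_; _∩_; ∣_∣; Nonempty)
open import Data.Product using (Σ; ∃; ∃-syntax; _×_; _,_; proj₁; proj₂)
open import Relation.Binary.PropositionalEquality using (_≡_; _≢_)
open import Function.Bundles using (_⇔_)
open import Function.Definitions using (Injective; Surjective)

record Graph : Set₁ where
  field
    V   : Set
    Adj : V → V → Set
open Graph public

Array : ℕ → ℕ → Set
Array n m = Fin (n * n) → Fin m → Fin n

-- OA(n,m): for any two distinct columns c, d, every ordered pair of symbols
-- occurs exactly once among the rows restricted to (c, d), i.e. the map
-- r ↦ (A r c , A r d) is a bijection Fin (n*n) → Fin n × Fin n.
IsOA : (n m : ℕ) → Array n m → Set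
IsOA n m A = ∀ (c d : Fin m) → c ≢ d →
  (∀ (a b : Fin n) → ∃[ r ] (A r c ≡ a × A r d ≡ b)) ×
  (∀ (r s : Fin (n * n)) → A r c ≡ A s c → A r d ≡ A s d → r ≡ s)

BlockGraph : (n m : ℕ) → Array n m → Graph
BlockGraph n m A = record
  { V   = Fin (n * n)
  ; Adj = λ r s → r ≢ s × ∃[ c ] (A r c ≡ A s c) }

-- Graphs with a finite vertex set Fin N (needed for cliques as subsets).
module _ {N : ℕ} (Adj : Fin N → Fin N → Set) where

  IsClique : ℕ → Subset N → Set
  IsClique ω S = ∣ S ∣ ≡ ω × (∀ u v → u ∈ S → v ∈ S → u ≢ v → Adj u v)

  CliqueRegular : ℕ → Set
  CliqueRegular ω =
    (∃[ u ] ∃[ v ] Adj u v) ×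
    (∀ u v → Adj u v →
       (∃[ S ] (IsClique ω S × u ∈ S × v ∈ S)) ×
       (∀ S T → IsClique ω S → u ∈ S → v ∈ S →
                IsClique ω T → u ∈ T → v ∈ T → S ≡ T))

  -- the ω-clique graph C_ω: vertices are cliques of order ω (equality of
  -- vertices is equality of the underlying vertex sets), adjacent iff
  -- distinct with nonempty intersection
  CliqueVertex : ℕ → Set
  CliqueVertex ω = Σ (Subset N) (IsClique ω)

  CliqueAdj : (ω : ℕ) → CliqueVertex ω → CliqueVertex ω → Set
  CliqueAdj ω K L = proj₁ K ≢ proj₁ L × Nonempty (proj₁ K ∩ proj₁ L)

CompleteMultipartite : (m n : ℕ) → Graph
CompleteMultipartite m n = record
  { V   = Fin m × Fin n
  ; Adj = λ x y → proj₁ x ≢ proj₁ y }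

-- C_ω(Γ) ≅ H: a bijection φ : V(H) → cliques of order ω (bijective with
-- respect to equality of underlying vertex sets) preserving and reflecting
-- adjacency.
CliqueGraphIso : {N : ℕ} (E : Fin N → Fin N → Set) (ω : ℕ) (H : Graph) → Set
CliqueGraphIso E ω H =
  Σ (V H → CliqueVertex E ω) λ φ →
    (∀ x y → proj₁ (φ x) ≡ proj₁ (φ y) → x ≡ y) ×
    (∀ (K : CliqueVertex E ω) → ∃[ x ] (proj₁ (φ x) ≡ proj₁ K)) ×
    (∀ x y → Graph.Adj H x y ⇔ CliqueAdj E ω (φ x) (φ y))

{-# OPTIONS --safe #-}
module Submission where

-- The lines L(c,a) = {r | A r c = a} are cliques of order n (any second column maps L(c,a)
-- bijectively onto the symbols); two rows lie on at most one common line, and lines in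
-- distinct columns meet in exactly one row. So everything reduces to showing that every
-- clique S of order n is a line. Fix u ∈ S. If S is constant in some column c, then
-- S ⊆ L(c, A u c) and both have n elements. Otherwise each column c contains a z_c ∈ S
-- with A z_c c ≠ A u c; let δ c be a column where u and z_c agree. Every x ∈ S other than u
-- agrees with u in some column c and with z_c in some column d, where d ∉ {c, δ c} (for
-- d = δ c, x would agree with u in two columns), and (c, d) determines x. Hence
-- |S| ≤ 1 + m(m - 2) = (m - 1)² < n, which is absurd.

open import Defs
open import Data.Nat using (ℕ; suc; _*_; _+_; _∸_; _<_; _≤_; _^_; z≤n; s≤s)
open import Data.Nat.Properties using (*-identityʳ; ≤-antisym; ≤-trans; ≤-reflexive; <-irrefl; <⇒≢)
open import Data.Nat.Tactic.RingSolver using (solve-∀)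
open import Data.Fin using (Fin; zero; suc; punchIn; punchOut; combine; _≟_)
open import Data.Fin.Properties
  using (injective⇒≤; suc-injective; punchInᵢ≢i; punchOut-injective; combine-injective; any?; all?; ¬∀⟶∃¬)
open import Data.Fin.Subset using (Subset; _∈_; _⊆_; _∩_; ∣_∣; inside; outside; Nonempty)
open import Data.Fin.Subset.Properties
  using (p⊂q⇒∣p∣<∣q∣; ⊆-antisym; _∈?_; nonempty?; Empty-unique; ∣⊥∣≡0; x∈p∩q⁺; x∈p∩q⁻)
open import Data.Vec using (_∷_; []; tabulate; here; there)
open import Data.Vec.Properties using (lookup∘tabulate; []=⇒lookup; lookup⇒[]=)
open import Data.Product using (∃; ∃-syntax; _×_; _,_; proj₁; proj₂; uncurry)
open import Data.Sum using (_⊎_; inj₁; inj₂)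
open import Function using (_∘_)
open import Function.Bundles using (_⇔_; mk⇔)
open import Function.Definitions using (Injective)
open import Relation.Binary.PropositionalEquality
open import Relation.Nullary using (yes; no; does; contradiction)
open import Relation.Nullary.Decidable using (_×-dec_; ¬?; decidable-stable; dec-true)
open import Relation.Unary using (Pred; Decidable)

record Enumeration {N : ℕ} (p : Subset N) : Set where
  field
    element            : Fin ∣ p ∣ → Fin N
    element-injective  : Injective _≡_ _≡_ element
    element-∈          : ∀ i → element i ∈ p
    element-surjective : ∀ {x} → x ∈ p → ∃[ i ] element i ≡ x

enumerate : ∀ {N} (p : Subset N) → Enumeration p
enumerate [] = record
  { element = λ ()
  ; element-injective = λ {}
  ; element-∈ = λ ()
  ; element-surjective = λ () }
enumerate (outside ∷ p) = record
  { element = suc ∘ element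
  ; element-injective = element-injective ∘ suc-injective
  ; element-∈ = there ∘ element-∈
  ; element-surjective = λ { (there x∈p) → let (i , eq) = element-surjective x∈p in i , cong suc eq } }
  where open Enumeration (enumerate p)
enumerate (inside ∷ p) = record
  { element = element′
  ; element-injective = injective′
  ; element-∈ = λ { zero → here ; (suc i) → there (element-∈ i) }
  ; element-surjective = λ
      { here → zero , refl
      ; (there x∈p) → let (i , eq) = element-surjective x∈p in suc i , cong suc eq } }
  where
  open Enumeration (enumerate p)
  element′ : Fin (suc ∣ p ∣) → Fin _
  element′ zero    = zero
  element′ (suc i) = suc (element i)
  injective′ : Injective _≡_ _≡_ element′
  injective′ {zero}  {zero}  _  = refl
  injective′ {suc i} {suc j} eq = cong suc (element-injective (suc-injective eq))

module _ {N : ℕ} {p : Subset N} where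

  injection⇒∣p∣≤ : ∀ {K} (f : ∀ x → x ∈ p → Fin K) →
    (∀ {x y} x∈p y∈p → f x x∈p ≡ f y y∈p → x ≡ y) → ∣ p ∣ ≤ K
  injection⇒∣p∣≤ f f-injective =
    injective⇒≤ (element-injective ∘ f-injective (element-∈ _) (element-∈ _))
    where open Enumeration (enumerate p)

  injection⇒≤∣p∣ : ∀ {K} (g : Fin K → Fin N) → Injective _≡_ _≡_ g → (∀ i → g i ∈ p) → K ≤ ∣ p ∣
  injection⇒≤∣p∣ {K} g g-injective g∈p = injective⇒≤ {f = index} index-injective
    where
    open Enumeration (enumerate p)
    index : Fin K → Fin ∣ p ∣
    index i = proj₁ (element-surjective (g∈p i))
    index-injective : Injective _≡_ _≡_ index
    index-injective {i} {j} eq = g-injective (begin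
      g i                  ≡⟨ sym (proj₂ (element-surjective (g∈p i))) ⟩
      element (index i)    ≡⟨ cong element eq ⟩
      element (index j)    ≡⟨ proj₂ (element-surjective (g∈p j)) ⟩
      g j                  ∎)
      where open ≡-Reasoning

  punctured-injection⇒∣p∣≤ : ∀ {K u} (f : ∀ x → x ∈ p → x ≢ u → Fin K) →
    (∀ {x y} x∈p y∈p x≢u y≢u → f x x∈p x≢u ≡ f y y∈p y≢u → x ≡ y) → ∣ p ∣ ≤ suc K
  punctured-injection⇒∣p∣≤ {K} {u} f f-injective = injection⇒∣p∣≤ f′ f′-injective
    where
    f′ : ∀ x → x ∈ p → Fin (suc K)
    f′ x x∈p with x ≟ u
    ... | yes _   = zero
    ... | no  x≢u = suc (f x x∈p x≢u)
    f′-injective : ∀ {x y} x∈p y∈p → f′ x x∈p ≡ f′ y y∈p → x ≡ y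
    f′-injective {x} {y} x∈p y∈p eq with x ≟ u | y ≟ u
    ... | yes x≡u | yes y≡u = trans x≡u (sym y≡u)
    ... | no  x≢u | no  y≢u = f-injective x∈p y∈p x≢u y≢u (suc-injective eq)

∣p∣>0⇒Nonempty : ∀ {N} {p : Subset N} → 0 < ∣ p ∣ → Nonempty p
∣p∣>0⇒Nonempty {N} {p} 0<∣p∣ with nonempty? p
... | yes ne = ne
... | no ¬ne = contradiction (trans (cong ∣_∣ (Empty-unique ¬ne)) (∣⊥∣≡0 N)) (<⇒≢ 0<∣p∣ ∘ sym)

⊆∧∣q∣≤∣p∣⇒p≡q : ∀ {N} {p q : Subset N} → p ⊆ q → ∣ q ∣ ≤ ∣ p ∣ → p ≡ q
⊆∧∣q∣≤∣p∣⇒p≡q {p = p} p⊆q ∣q∣≤∣p∣ = ⊆-antisym p⊆q q⊆p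
  where
  q⊆p : _ ⊆ p
  q⊆p {x} x∈q with x ∈? p
  ... | yes x∈p = x∈p
  ... | no  x∉p = contradiction (≤-trans (p⊂q⇒∣p∣<∣q∣ (p⊆q , x , x∈q , x∉p)) ∣q∣≤∣p∣) (<-irrefl refl)

module _ {N ℓ} {P : Pred (Fin N) ℓ} (P? : Decidable P) where

  subset : Subset N
  subset = tabulate (does ∘ P?)

  ∈-subset⁺ : ∀ {x} → P x → x ∈ subset
  ∈-subset⁺ {x} px = lookup⇒[]= x subset (trans (lookup∘tabulate (does ∘ P?) x) (dec-true (P? x) px))

  ∈-subset⁻ : ∀ {x} → x ∈ subset → P x
  ∈-subset⁻ {x} x∈ with P? x | trans (sym (lookup∘tabulate (does ∘ P?) x)) ([]=⇒lookup x∈)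
  ... | yes px | _ = px

another : ∀ {K} → 2 ≤ K → (i : Fin K) → ∃[ j ] i ≢ j
another (s≤s (s≤s _)) i = punchIn i zero , punchInᵢ≢i i zero ∘ sym

distinct-pair : ∀ {K} → 2 ≤ K → ∃ λ (i : Fin K) → ∃[ j ] i ≢ j
distinct-pair (s≤s (s≤s _)) = zero , suc zero , λ ()

punchOut₂ : ∀ {k} {i j d : Fin (2 + k)} → i ≢ j → i ≢ d → j ≢ d → Fin k
punchOut₂ i≢j i≢d j≢d =
  punchOut {i = punchOut i≢j} {j = punchOut i≢d} (j≢d ∘ punchOut-injective i≢j i≢d)

punchOut₂-injective : ∀ {k} {i j d e : Fin (2 + k)} (i≢j : i ≢ j)
  (i≢d : i ≢ d) (j≢d : j ≢ d) (i≢e : i ≢ e) (j≢e : j ≢ e) →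
  punchOut₂ i≢j i≢d j≢d ≡ punchOut₂ i≢j i≢e j≢e → d ≡ e
punchOut₂-injective i≢j i≢d j≢d i≢e j≢e =
  punchOut-injective i≢d i≢e ∘
  punchOut-injective (j≢d ∘ punchOut-injective i≢j i≢d) (j≢e ∘ punchOut-injective i≢j i≢e)

[1+k]^2≡1+[2+k]*k : ∀ k → suc k ^ 2 ≡ suc ((2 + k) * k)
[1+k]^2≡1+[2+k]*k k = trans (cong (suc k *_) (*-identityʳ (suc k))) (square k)
  where
  square : ∀ k → (1 + k) * (1 + k) ≡ 1 + (2 + k) * k
  square = solve-∀

module _ {N ω : ℕ} {E : Fin N → Fin N → Set} {I : Set} (K : I → Subset N) where

  cover⇒CliqueRegular :
    (∃[ u ] ∃[ v ] E u v) →
    (∀ i → IsClique E ω (K i)) →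
    (∀ S → IsClique E ω S → ∃[ i ] S ≡ K i) →
    (∀ {u v} → E u v → ∃[ i ] (u ∈ K i × v ∈ K i)) →
    (∀ {u v} i j → E u v → u ∈ K i → v ∈ K i → u ∈ K j → v ∈ K j → K i ≡ K j) →
    CliqueRegular E ω
  cover⇒CliqueRegular edge K-clique cliques-in-K edge-in-K edge-in-one-K =
    edge , λ u v uv → clique-through uv , unique uv
    where
    clique-through : ∀ {u v} → E u v → ∃[ S ] (IsClique E ω S × u ∈ S × v ∈ S)
    clique-through uv with edge-in-K uv
    ... | i , u∈ , v∈ = K i , K-clique i , u∈ , v∈
    unique : ∀ {u v} → E u v → ∀ S T →
      IsClique E ω S → u ∈ S → v ∈ S → IsClique E ω T → u ∈ T → v ∈ T → S ≡ T
    unique uv S T S-clique u∈S v∈S T-clique u∈T v∈T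
      with cliques-in-K S S-clique | cliques-in-K T T-clique
    ... | i , refl | j , refl = edge-in-one-K i j uv u∈S v∈S u∈T v∈T

module OrthogonalArray {n k : ℕ} (A : Array n (2 + k)) (oa : IsOA n (2 + k) A) where

  m : ℕ
  m = 2 + k

  Row : Set
  Row = Fin (n * n)

  Γ : Row → Row → Set
  Γ = Graph.Adj (BlockGraph n m A)

  differs⇒≢ : ∀ {x y c} → A x c ≢ A y c → x ≢ y
  differs⇒≢ Axc≢Ayc refl = Axc≢Ayc refl

  agrees-differs⇒≢ : ∀ {x y c d} → A x c ≢ A y c → A x d ≡ A y d → c ≢ d
  agrees-differs⇒≢ Axc≢Ayc Axd≡Ayd refl = Axc≢Ayc Axd≡Ayd

  agree₂⇒≡ : ∀ {c d r s} → c ≢ d → A r c ≡ A s c → A r d ≡ A s d → r ≡ s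
  agree₂⇒≡ c≢d = proj₂ (oa _ _ c≢d) _ _

  other-column : (c : Fin m) → ∃[ d ] c ≢ d
  other-column = another (s≤s (s≤s z≤n))

  line : Fin m → Fin n → Subset (n * n)
  line c a = subset (λ r → A r c ≟ a)

  ∈line⁺ : ∀ {c a r} → A r c ≡ a → r ∈ line c a
  ∈line⁺ {c} {a} = ∈-subset⁺ (λ r → A r c ≟ a)

  ∈line⁻ : ∀ {c a r} → r ∈ line c a → A r c ≡ a
  ∈line⁻ {c} {a} = ∈-subset⁻ (λ r → A r c ≟ a)

  parallel-lines-disjoint : ∀ {c a b r} → r ∈ line c a → r ∈ line c b → a ≡ b
  parallel-lines-disjoint r∈ r∈′ = trans (sym (∈line⁻ r∈)) (∈line⁻ r∈′)

  transversal-lines-meet : ∀ {c d} → c ≢ d → ∀ a b → ∃[ r ] (r ∈ line c a × r ∈ line d b)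
  transversal-lines-meet c≢d a b with proj₁ (oa _ _ c≢d) a b
  ... | r , Arc≡a , Ard≡b = r , ∈line⁺ Arc≡a , ∈line⁺ Ard≡b

  transversal-lines-meet-once : ∀ {c d a b r s} → c ≢ d →
    r ∈ line c a → s ∈ line c a → r ∈ line d b → s ∈ line d b → r ≡ s
  transversal-lines-meet-once c≢d r∈ s∈ r∈′ s∈′ =
    agree₂⇒≡ c≢d (trans (∈line⁻ r∈) (sym (∈line⁻ s∈))) (trans (∈line⁻ r∈′) (sym (∈line⁻ s∈′)))

  ∣line∣≡n : ∀ c a → ∣ line c a ∣ ≡ n
  ∣line∣≡n c a with other-column c
  ... | d , c≢d = ≤-antisym
      (injection⇒∣p∣≤ (λ r _ → A r d)
         (λ r∈ s∈ Ard≡Asd → transversal-lines-meet-once c≢d r∈ s∈ (∈line⁺ Ard≡Asd) (∈line⁺ refl)))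
      (injection⇒≤∣p∣ meet meet-injective (proj₁ ∘ proj₂ ∘ transversal-lines-meet c≢d a))
    where
    meet : Fin n → Row
    meet b = proj₁ (transversal-lines-meet c≢d a b)
    meet∈ : ∀ b → meet b ∈ line d b
    meet∈ b = proj₂ (proj₂ (transversal-lines-meet c≢d a b))
    meet-injective : Injective _≡_ _≡_ meet
    meet-injective {b} {b′} eq =
      parallel-lines-disjoint (meet∈ b) (subst (_∈ line d b′) (sym eq) (meet∈ b′))

  line-isClique : ∀ c a → IsClique Γ n (line c a)
  line-isClique c a =
    ∣line∣≡n c a , λ u v u∈ v∈ u≢v → u≢v , c , trans (∈line⁻ u∈) (sym (∈line⁻ v∈))

  edge-on-line : ∀ {u v} → Γ u v → ∃[ i ] (u ∈ uncurry line i × v ∈ uncurry line i)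
  edge-on-line {u} (_ , c , Auc≡Avc) = (c , A u c) , ∈line⁺ refl , ∈line⁺ (sym Auc≡Avc)

  edge-on-one-line : ∀ {u v} i j → Γ u v →
    u ∈ uncurry line i → v ∈ uncurry line i → u ∈ uncurry line j → v ∈ uncurry line j →
    uncurry line i ≡ uncurry line j
  edge-on-one-line (c , a) (d , b) (u≢v , _) u∈ v∈ u∈′ v∈′ with c ≟ d
  ... | yes refl = cong (line c) (parallel-lines-disjoint u∈ u∈′)
  ... | no  c≢d  = contradiction (transversal-lines-meet-once c≢d u∈ v∈ u∈′ v∈′) u≢v

  module _ (2≤n : 2 ≤ n) where

    edge : ∃[ u ] ∃[ v ] Γ u v
    edge with distinct-pair 2≤n
    ... | a , b , a≢b
      with transversal-lines-meet {zero} {suc zero} (λ ()) a a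
         | transversal-lines-meet {zero} {suc zero} (λ ()) a b
    ...   | u , u∈ , u∈′ | v , v∈ , v∈′ =
      u , v , u≢v , zero , trans (∈line⁻ u∈) (sym (∈line⁻ v∈))
      where
      u≢v : u ≢ v
      u≢v u≡v = a≢b (parallel-lines-disjoint u∈′ (subst (_∈ line (suc zero) b) (sym u≡v) v∈′))

    line-injective : ∀ {c a d b} → line c a ≡ line d b → (c , a) ≡ (d , b)
    line-injective {c} {a} {d} {b} eq with c ≟ d
    ... | yes refl with transversal-lines-meet (proj₂ (other-column c)) a a
    ...   | r , r∈ , _ = cong (c ,_) (parallel-lines-disjoint r∈ (subst (r ∈_) eq r∈))
    line-injective {c} {a} {d} {b} eq | no c≢d with another 2≤n b
    ...   | b′ , b≢b′ with transversal-lines-meet c≢d a b′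
    ...     | r , r∈ , r∈′ =
      contradiction (parallel-lines-disjoint (subst (r ∈_) eq r∈) r∈′) b≢b′

    ≢⇔lines-meet : ∀ {c a d b} → c ≢ d ⇔ (line c a ≢ line d b × Nonempty (line c a ∩ line d b))
    ≢⇔lines-meet {c} {a} {d} {b} = mk⇔ to from
      where
      to : c ≢ d → line c a ≢ line d b × Nonempty (line c a ∩ line d b)
      to c≢d with transversal-lines-meet c≢d a b
      ... | r , r∈ , r∈′ = c≢d ∘ cong proj₁ ∘ line-injective , r , x∈p∩q⁺ (r∈ , r∈′)
      from : line c a ≢ line d b × Nonempty (line c a ∩ line d b) → c ≢ d
      from (lines≢ , r , r∈∩) refl with x∈p∩q⁻ (line c a) (line c b) r∈∩
      ... | r∈ , r∈′ = lines≢ (cong (line c) (parallel-lines-disjoint r∈ r∈′))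

  module _ (S : Subset (n * n)) (u : Row) where

    Scattered-at : Fin m → Set
    Scattered-at c = ∃[ z ] (z ∈ S × A z c ≢ A u c)

    scattered-at? : Decidable Scattered-at
    scattered-at? c = any? (λ z → z ∈? S ×-dec ¬? (A z c ≟ A u c))

    constant-or-scattered : (∃[ c ] ∀ {x} → x ∈ S → A x c ≡ A u c) ⊎ (∀ c → Scattered-at c)
    constant-or-scattered with all? scattered-at?
    ... | yes scattered = inj₂ scattered
    ... | no ¬scattered with ¬∀⟶∃¬ m Scattered-at scattered-at? ¬scattered
    ...   | c , ¬scattered-at = inj₁ (c , λ {x} x∈S →
            decidable-stable (A x c ≟ A u c) (λ Axc≢Auc → ¬scattered-at (x , x∈S , Axc≢Auc)))

    module _ (S-pairwise : ∀ x y → x ∈ S → y ∈ S → x ≢ y → Γ x y) (u∈S : u ∈ S)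
             (scattered : ∀ c → Scattered-at c) where

      private
        meet : ∀ {x y} → x ∈ S → y ∈ S → x ≢ y → ∃[ c ] A x c ≡ A y c
        meet x∈S y∈S x≢y = proj₂ (S-pairwise _ _ x∈S y∈S x≢y)

        z : Fin m → Row
        z c = proj₁ (scattered c)

        z∈S : ∀ c → z c ∈ S
        z∈S c = proj₁ (proj₂ (scattered c))

        u-differs-z : ∀ c → A u c ≢ A (z c) c
        u-differs-z c = proj₂ (proj₂ (scattered c)) ∘ sym

        δ : Fin m → Fin m
        δ c = proj₁ (meet u∈S (z∈S c) (differs⇒≢ (u-differs-z c)))

        δ-agrees : ∀ c → A u (δ c) ≡ A (z c) (δ c)
        δ-agrees c = proj₂ (meet u∈S (z∈S c) (differs⇒≢ (u-differs-z c)))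

        c≢δc : ∀ c → c ≢ δ c
        c≢δc c = agrees-differs⇒≢ (u-differs-z c) (δ-agrees c)

        encode : ∀ {c d} → c ≢ d → δ c ≢ d → Fin (m * k)
        encode {c} c≢d δc≢d = combine c (punchOut₂ (c≢δc c) c≢d δc≢d)

        encode-injective : ∀ {c d c′ d′}
          (c≢d : c ≢ d) (δc≢d : δ c ≢ d) (c′≢d′ : c′ ≢ d′) (δc′≢d′ : δ c′ ≢ d′) →
          encode c≢d δc≢d ≡ encode c′≢d′ δc′≢d′ → c ≡ c′ × d ≡ d′
        encode-injective {c} {_} {c′} c≢d δc≢d c′≢d′ δc′≢d′ eq with combine-injective c _ c′ _ eq
        ... | refl , eq′ = refl , punchOut₂-injective (c≢δc c) c≢d δc≢d c′≢d′ δc′≢d′ eq′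

        module _ {x} (x∈S : x ∈ S) (x≢u : x ≢ u) where

          first : Fin m
          first = proj₁ (meet x∈S u∈S x≢u)

          first-agrees : A x first ≡ A u first
          first-agrees = proj₂ (meet x∈S u∈S x≢u)

          x-differs-z : A x first ≢ A (z first) first
          x-differs-z Axc≡Azc = u-differs-z first (trans (sym first-agrees) Axc≡Azc)

          second : Fin m
          second = proj₁ (meet x∈S (z∈S first) (differs⇒≢ x-differs-z))

          second-agrees : A x second ≡ A (z first) second
          second-agrees = proj₂ (meet x∈S (z∈S first) (differs⇒≢ x-differs-z))

          first≢second : first ≢ second
          first≢second = agrees-differs⇒≢ x-differs-z second-agrees

          δ≢second : δ first ≢ second
          δ≢second δ≡second = x≢u (agree₂⇒≡ (c≢δc first) first-agrees (begin
            A x (δ first)          ≡⟨ cong (A x) δ≡second ⟩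
            A x second             ≡⟨ second-agrees ⟩
            A (z first) second     ≡⟨ cong (A (z first)) (sym δ≡second) ⟩
            A (z first) (δ first)  ≡⟨ sym (δ-agrees first) ⟩
            A u (δ first)          ∎))
            where open ≡-Reasoning

          code : Fin (m * k)
          code = encode first≢second δ≢second

        determined-by-columns : ∀ {x y c c′ d d′} → c ≡ c′ → d ≡ d′ → c ≢ d →
          A x c ≡ A u c → A y c′ ≡ A u c′ → A x d ≡ A (z c) d → A y d′ ≡ A (z c′) d′ → x ≡ y
        determined-by-columns refl refl c≢d Axc Ayc Axd Ayd =
          agree₂⇒≡ c≢d (trans Axc (sym Ayc)) (trans Axd (sym Ayd))

        code-injective : ∀ {x y} (x∈S : x ∈ S) (y∈S : y ∈ S) (x≢u : x ≢ u) (y≢u : y ≢ u) →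
          code x∈S x≢u ≡ code y∈S y≢u → x ≡ y
        code-injective x∈S y∈S x≢u y≢u eq
          with encode-injective (first≢second x∈S x≢u) (δ≢second x∈S x≢u)
                                (first≢second y∈S y≢u) (δ≢second y∈S y≢u) eq
        ... | first≡ , second≡ = determined-by-columns first≡ second≡ (first≢second x∈S x≢u)
          (first-agrees x∈S x≢u) (first-agrees y∈S y≢u) (second-agrees x∈S x≢u) (second-agrees y∈S y≢u)

      ∣scattered∣≤ : ∣ S ∣ ≤ suc (m * k)
      ∣scattered∣≤ = punctured-injection⇒∣p∣≤ (λ _ → code) code-injective

  clique⇒line : suc k ^ 2 < n → ∀ S → IsClique Γ n S → ∃[ i ] S ≡ uncurry line i
  clique⇒line k+1²<n S (∣S∣≡n , S-pairwise)
    with ∣p∣>0⇒Nonempty (subst (0 <_) (sym ∣S∣≡n) (≤-trans (s≤s z≤n) k+1²<n))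
  ... | u , u∈S with constant-or-scattered S u
  ...   | inj₁ (c , constant) = (c , A u c) ,
          ⊆∧∣q∣≤∣p∣⇒p≡q (∈line⁺ ∘ constant) (≤-reflexive (trans (∣line∣≡n c (A u c)) (sym ∣S∣≡n)))
  ...   | inj₂ scattered = contradiction
          (≤-trans (s≤s (∣scattered∣≤ S u S-pairwise u∈S scattered))
                   (subst (_< n) ([1+k]^2≡1+[2+k]*k k) k+1²<n))
          (<-irrefl ∣S∣≡n)

  cliqueGraphIso : 2 ≤ n → suc k ^ 2 < n → CliqueGraphIso Γ n (CompleteMultipartite m n)
  cliqueGraphIso 2≤n k+1²<n =
      φ
    , (λ _ _ → line-injective 2≤n)
    , (λ (S , S-clique) → let (i , S≡line) = clique⇒line k+1²<n S S-clique in i , sym S≡line)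
    , (λ _ _ → ≢⇔lines-meet 2≤n)
    where
    φ : Fin m × Fin n → CliqueVertex Γ n
    φ (c , a) = line c a , line-isClique c a

theorem10 : (n m : ℕ) (A : Array n m) → IsOA n m A → 2 ≤ m → (m ∸ 1) ^ 2 < n →
    CliqueRegular (Graph.Adj (BlockGraph n m A)) n ×
    CliqueGraphIso (Graph.Adj (BlockGraph n m A)) n (CompleteMultipartite m n)
theorem10 n (suc (suc k)) A oa (s≤s (s≤s _)) k+1²<n =
    cover⇒CliqueRegular (uncurry line) (edge 2≤n) (uncurry line-isClique)
      (clique⇒line k+1²<n) edge-on-line edge-on-one-line
  , cliqueGraphIso 2≤n k+1²<n
  where
  open OrthogonalArray A oa
  2≤n : 2 ≤ n
  2≤n = ≤-trans (s≤s (s≤s z≤n)) (subst (_< n) ([1+k]^2≡1+[2+k]*k k) k+1²<n)
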